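{- Let $\mathbf{U}=(\mathbf{T},G,H)$ be an $\mathrm{itKI}_{c1}$-algebra. Then the maps $S\mapsto D_S=\{u\in T:\ \sim u\Rightarrow c\in S\text{ and }1\Rightarrow(u\vee c)\in S\}$ and $D\mapsto S_D=D\cap C(T)$ establish an order isomorphism between the lattice of tense 1-filters of $\mathrm{C}(\mathbf{U})$ and the lattice of centered tense deductive systems of $\mathbf{U}$.
   Context: A centered Kleene algebra is $\langle T,\wedge,\vee,\sim,c,0,1\rangle$ with bounded distributive lattice reduct, $\sim\sim x=x$, $\sim(x\vee y)=\sim x\wedge\sim y$, $x\wedge\sim x\le y\vee\sim y$, $\sim c=c$. A KI-algebra is $\langle T,\wedge,\vee,\Rightarrow,\sim,c,0,1\rangle$ with centered Kleene reduct such that: $(a\Rightarrow b)\wedge(a\Rightarrow d)=a\Rightarrow(b\wedge d)$, $(a\Rightarrow d)\wedge(b\Rightarrow d)=(a\vee b)\Rightarrow d$, $0\Rightarrow a=1$, $a\Rightarrow 1=1$; $(x\wedge(x\Rightarrow y))\vee c\le y\vee c$; $c\Rightarrow c=1$; $(x\Rightarrow y)\wedge c=(\sim x\vee y)\wedge c$; $(x\Rightarrow\sim y)\vee c=(x\Rightarrow(\sim y\vee c))\wedge(y\Rightarrow(\sim x\vee c))$. A tense centered KI-algebra is $(\mathbf{T},G,H)$ with $F(x):=\sim G(\sim x)$, $P(x):=\sim H(\sim x)$ satisfying $G(1)=H(1)=1$; $G,H$ preserve $\wedge$; $x\le GP(x)$, $x\le HF(x)$; $G(x\vee y)\le G(x)\vee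 F(y)$, $H(x\vee y)\le H(x)\vee P(y)$; $G(x\Rightarrow y)\le G(x)\Rightarrow G(y)$, $H(x\Rightarrow y)\le H(x)\Rightarrow H(y)$; $G(x\Rightarrow y)\le F(x)\Rightarrow F(y)$, $H(x\Rightarrow y)\le P(x)\Rightarrow P(y)$; $G(c)=c=H(c)$. An $\mathrm{itKI}_{c1}$-algebra is a tense centered KI-algebra satisfying $x\Rightarrow x=1$ and (CK): for all $x,y\ge c$ with $x\wedge y\le c$ there is $z$ with $z\vee c=x$ and $\sim z\vee c=y$. $C(T)=\{x\in T:x\ge c\}$; $\mathrm{C}(\mathbf{U})$ is $C(T)$ with $\wedge,\vee,\Rightarrow,G,H,F,P$ restricted, bottom $c$, top $1$. A tense 1-filter of $\mathrm{C}(\mathbf{U})$ is a lattice filter $S$ of $C(T)$ with $((a\wedge f)\Rightarrow b)\Rightarrow(a\Rightarrow b)\in S$ for all $a,b\in C(T)$, $f\in S$, and closed under $G,H$. A tense deductive system of $\mathbf{U}$ is $D\subseteq T$ with $1\in D$; $u,u\Rightarrow v\in D$ implies $v\in D$; $u\in D$ implies $G(u),H(u)\in D$. It is centered if $D\cap C(T)$ is a tense 1-filter of $\mathrm{C}(\mathbf{U})$ and for every $u\in T$, $\sim u\Rightarrow c\in D$ and $1\Rightarrow(u\vee c)\in D$ imply $u\in D$. Both lattices are ordered by inclusion. -}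

module Defs where

open import Level using (Level; suc)
open import Data.Product using (Σ; ∃; _×_; _,_)
open import Relation.Binary.PropositionalEquality using (_≡_)
open import Relation.Unary using (Pred; _⊆_)

-- itKI_{c1}-algebra (tense centered KI-algebra with x ⇒ x = 1 and (CK)),
-- equality is propositional equality on the carrier, order x ≤ y := x ∧ y ≡ x.
record ItKIc1 (a : Level) : Set (suc a) where
  field
    T : Set a
    _∧_ _∨_ _⇒_ : T → T → T
    ∼ G H : T → T
    c 𝟘 𝟙 : T

  infixr 7 _∧_
  infixr 6 _∨_
  infixr 5 _⇒_

  _≤_ : T → T → Set a
  x ≤ y = x ∧ y ≡ x

  F : T → T
  F x = ∼ (G (∼ x))

  P : T → T
  P x = ∼ (H (∼ x))

  field
    ∧-assoc : ∀ x y z → (x ∧ y) ∧ z ≡ x ∧ (y ∧ z)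
    ∨-assoc : ∀ x y z → (x ∨ y) ∨ z ≡ x ∨ (y ∨ z)
    ∧-comm : ∀ x y → x ∧ y ≡ y ∧ x
    ∨-comm : ∀ x y → x ∨ y ≡ y ∨ x
    ∧-absorb : ∀ x y → x ∧ (x ∨ y) ≡ x
    ∨-absorb : ∀ x y → x ∨ (x ∧ y) ≡ x
    ∧-distrib-∨ : ∀ x y z → x ∧ (y ∨ z) ≡ (x ∧ y) ∨ (x ∧ z)
    𝟘-bot : ∀ x → 𝟘 ∧ x ≡ 𝟘
    𝟙-top : ∀ x → x ∧ 𝟙 ≡ x
    ∼-invol : ∀ x → ∼ (∼ x) ≡ x
    ∼-deMorgan : ∀ x y → ∼ (x ∨ y) ≡ ∼ x ∧ ∼ y
    kleene : ∀ x y → (x ∧ ∼ x) ≤ (y ∨ ∼ y)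
    ∼-c : ∼ c ≡ c
    ⇒-∧ : ∀ a b d → (a ⇒ b) ∧ (a ⇒ d) ≡ a ⇒ (b ∧ d)
    ⇒-∨ : ∀ a b d → (a ⇒ d) ∧ (b ⇒ d) ≡ (a ∨ b) ⇒ d
    𝟘-⇒ : ∀ x → 𝟘 ⇒ x ≡ 𝟙
    ⇒-𝟙 : ∀ x → x ⇒ 𝟙 ≡ 𝟙
    ki-mp : ∀ x y → ((x ∧ (x ⇒ y)) ∨ c) ≤ (y ∨ c)
    c⇒c : c ⇒ c ≡ 𝟙
    ki-c : ∀ x y → (x ⇒ y) ∧ c ≡ (∼ x ∨ y) ∧ c
    ki-∼ : ∀ x y → (x ⇒ ∼ y) ∨ c ≡ (x ⇒ (∼ y ∨ c)) ∧ (y ⇒ (∼ x ∨ c))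
    G𝟙 : G 𝟙 ≡ 𝟙
    H𝟙 : H 𝟙 ≡ 𝟙
    G-∧ : ∀ x y → G (x ∧ y) ≡ G x ∧ G y
    H-∧ : ∀ x y → H (x ∧ y) ≡ H x ∧ H y
    x≤GPx : ∀ x → x ≤ G (P x)
    x≤HFx : ∀ x → x ≤ H (F x)
    G-∨ : ∀ x y → G (x ∨ y) ≤ (G x ∨ F y)
    H-∨ : ∀ x y → H (x ∨ y) ≤ (H x ∨ P y)
    G-⇒ : ∀ x y → G (x ⇒ y) ≤ (G x ⇒ G y)
    H-⇒ : ∀ x y → H (x ⇒ y) ≤ (H x ⇒ H y)
    G-⇒F : ∀ x y → G (x ⇒ y) ≤ (F x ⇒ F y)
    H-⇒P : ∀ x y → H (x ⇒ y) ≤ (P x ⇒ P y)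
    Gc : G c ≡ c
    Hc : H c ≡ c
    ⇒-refl : ∀ x → x ⇒ x ≡ 𝟙
    CK : ∀ x y → c ≤ x → c ≤ y → (x ∧ y) ≤ c →
         ∃ λ z → (z ∨ c ≡ x) × (∼ z ∨ c ≡ y)

module _ {a : Level} (U : ItKIc1 a) where
  open ItKIc1 U

  C : Pred T a
  C x = c ≤ x

  record Tense1Filter (S : Pred T a) : Set a where
    field
      sub-C : S ⊆ C
      has-𝟙 : S 𝟙
      up-closed : ∀ {x y} → S x → C y → x ≤ y → S y
      ∧-closed : ∀ {x y} → S x → S y → S (x ∧ y)
      one-cond : ∀ {a' b f} → C a' → C b → S f →
                 S (((a' ∧ f) ⇒ b) ⇒ (a' ⇒ b))
      G-closed : ∀ {x} → S x → S (G x)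
      H-closed : ∀ {x} → S x → S (H x)

  record TenseDS (D : Pred T a) : Set a where
    field
      has-𝟙 : D 𝟙
      mp : ∀ {u v} → D u → D (u ⇒ v) → D v
      G-closed : ∀ {u} → D u → D (G u)
      H-closed : ∀ {u} → D u → D (H u)

  S[_] : Pred T a → Pred T a
  S[ D ] x = D x × C x

  D[_] : Pred T a → Pred T a
  D[ S ] u = S (∼ u ⇒ c) × S (𝟙 ⇒ (u ∨ c))

  record CenteredTenseDS (D : Pred T a) : Set a where
    field
      isTenseDS : TenseDS D
      filter : Tense1Filter S[ D ]
      centered : ∀ u → D (∼ u ⇒ c) → D (𝟙 ⇒ (u ∨ c)) → D u

  _≐_ : Pred T a → Pred T a → Set a
  A ≐ B = (A ⊆ B) × (B ⊆ A)

  -- The two maps are well defined, mutually inverse and monotone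
  -- (hence an order isomorphism of the two lattices ordered by ⊆).
  OrderIsoFiltersCDS : Set (suc a)
  OrderIsoFiltersCDS =
      (∀ S → Tense1Filter S → CenteredTenseDS D[ S ])
    × (∀ D → CenteredTenseDS D → Tense1Filter S[ D ])
    × (∀ S → Tense1Filter S → S[ D[ S ] ] ≐ S)
    × (∀ D → CenteredTenseDS D → D[ S[ D ] ] ≐ D)
    × (∀ S S' → Tense1Filter S → Tense1Filter S' → S ⊆ S' → D[ S ] ⊆ D[ S' ])
    × (∀ D D' → CenteredTenseDS D → CenteredTenseDS D' → D ⊆ D' → S[ D ] ⊆ S[ D' ])

-- For w ≥ c, membership of w in a tense 1-filter S is equivalent to that of 1 ⇒ w (the
-- 1-filter condition with a = 1 gives 1 ⇒ (1 ⇒ w) ∈ S, and 1 ⇒ w ≤ w), while ∼ w ⇒ c = 1;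
-- hence D_S ∩ C(T) = S. Conversely, if u lies in a centered deductive system D then
-- u ∨ c ∈ D by modus ponens, and ∼ u ⇒ c ∈ D by the 1-filter condition with a = ∼ u ∨ c,
-- f = u ∨ c, b = c, because (∼ u ∨ c) ∧ (u ∨ c) = c in a Kleene algebra; centeredness then
-- gives D_{S_D} = D. Modus ponens in D_S rests on the identity ∼ (u ⇒ v) ∨ c = (u ∧ ∼ v) ∨ c,
-- a consequence of (x ⇒ y) ∧ c = (∼ x ∨ y) ∧ c.
module Submission where

open import Level using (Level)
open import Defs
open import Data.Product using (_,_; proj₁)
open import Relation.Binary.PropositionalEquality
open import Relation.Unary using (Pred; _⊆_)

module _ {ℓ : Level} (U : ItKIc1 ℓ) where
  open ItKIc1 U
  open ≡-Reasoning

  ∧-idem : ∀ x → x ∧ x ≡ x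
  ∧-idem x = trans (cong (x ∧_) (sym (∨-absorb x x))) (∧-absorb x (x ∧ x))

  ≤-refl : ∀ x → x ≤ x
  ≤-refl = ∧-idem

  ≤-trans : ∀ {x y z} → x ≤ y → y ≤ z → x ≤ z
  ≤-trans {x} {y} {z} x≤y y≤z = begin
    x ∧ z        ≡⟨ cong (_∧ z) (sym x≤y) ⟩
    (x ∧ y) ∧ z  ≡⟨ ∧-assoc x y z ⟩
    x ∧ (y ∧ z)  ≡⟨ cong (x ∧_) y≤z ⟩
    x ∧ y        ≡⟨ x≤y ⟩
    x            ∎

  ≤-antisym : ∀ {x y} → x ≤ y → y ≤ x → x ≡ y
  ≤-antisym {x} {y} x≤y y≤x = trans (sym x≤y) (trans (∧-comm x y) y≤x)

  x≤y⇒x∨y≡y : ∀ {x y} → x ≤ y → x ∨ y ≡ y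
  x≤y⇒x∨y≡y {x} {y} x≤y = begin
    x ∨ y        ≡⟨ cong (_∨ y) (sym x≤y) ⟩
    (x ∧ y) ∨ y  ≡⟨ ∨-comm (x ∧ y) y ⟩
    y ∨ (x ∧ y)  ≡⟨ cong (y ∨_) (∧-comm x y) ⟩
    y ∨ (y ∧ x)  ≡⟨ ∨-absorb y x ⟩
    y            ∎

  x≤x∨y : ∀ x y → x ≤ (x ∨ y)
  x≤x∨y = ∧-absorb

  y≤x∨y : ∀ x y → y ≤ (x ∨ y)
  y≤x∨y x y = subst (y ≤_) (∨-comm y x) (x≤x∨y y x)

  x∧y≤x : ∀ x y → (x ∧ y) ≤ x
  x∧y≤x x y = begin
    (x ∧ y) ∧ x  ≡⟨ ∧-comm (x ∧ y) x ⟩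
    x ∧ (x ∧ y)  ≡⟨ sym (∧-assoc x x y) ⟩
    (x ∧ x) ∧ y  ≡⟨ cong (_∧ y) (∧-idem x) ⟩
    x ∧ y        ∎

  x∧y≤y : ∀ x y → (x ∧ y) ≤ y
  x∧y≤y x y = subst (_≤ y) (∧-comm y x) (x∧y≤x y x)

  x≤𝟙 : ∀ x → x ≤ 𝟙
  x≤𝟙 = 𝟙-top

  ∧-identityˡ : ∀ x → 𝟙 ∧ x ≡ x
  ∧-identityˡ x = trans (∧-comm 𝟙 x) (𝟙-top x)

  ∨-distribʳ-∧ : ∀ x y z → (x ∧ y) ∨ z ≡ (x ∨ z) ∧ (y ∨ z)
  ∨-distribʳ-∧ x y z = sym (begin
    (x ∨ z) ∧ (y ∨ z)              ≡⟨ ∧-distrib-∨ (x ∨ z) y z ⟩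
    ((x ∨ z) ∧ y) ∨ ((x ∨ z) ∧ z)  ≡⟨ cong₂ _∨_ (trans (∧-comm (x ∨ z) y) (∧-distrib-∨ y x z))
                                                 (trans (∧-comm (x ∨ z) z) z∧[x∨z]≡z) ⟩
    ((y ∧ x) ∨ (y ∧ z)) ∨ z        ≡⟨ ∨-assoc (y ∧ x) (y ∧ z) z ⟩
    (y ∧ x) ∨ ((y ∧ z) ∨ z)        ≡⟨ cong₂ _∨_ (∧-comm y x) (x≤y⇒x∨y≡y (x∧y≤y y z)) ⟩
    (x ∧ y) ∨ z                    ∎)
    where
    z∧[x∨z]≡z : z ∧ (x ∨ z) ≡ z
    z∧[x∨z]≡z = trans (cong (z ∧_) (∨-comm x z)) (∧-absorb z x)

  c≤x∨c : ∀ x → C U (x ∨ c)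
  c≤x∨c x = y≤x∨y x c

  C⇒x∨c≡x : ∀ {x} → C U x → x ∨ c ≡ x
  C⇒x∨c≡x {x} c≤x = trans (∨-comm x c) (x≤y⇒x∨y≡y c≤x)

  ∼-antitone : ∀ {x y} → x ≤ y → ∼ y ≤ ∼ x
  ∼-antitone {x} {y} x≤y = subst (_≤ ∼ x) (sym ∼y≡∼x∧∼y) (x∧y≤x (∼ x) (∼ y))
    where
    ∼y≡∼x∧∼y : ∼ y ≡ ∼ x ∧ ∼ y
    ∼y≡∼x∧∼y = trans (cong ∼ (sym (x≤y⇒x∨y≡y x≤y))) (∼-deMorgan x y)

  ∼𝟙≡𝟘 : ∼ 𝟙 ≡ 𝟘
  ∼𝟙≡𝟘 = ≤-antisym (subst (∼ 𝟙 ≤_) (∼-invol 𝟘) (∼-antitone (x≤𝟙 (∼ 𝟘)))) (𝟘-bot (∼ 𝟙))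

  ∼-deMorgan-∧ : ∀ x y → ∼ (x ∧ y) ≡ ∼ x ∨ ∼ y
  ∼-deMorgan-∧ x y = begin
    ∼ (x ∧ y)              ≡⟨ cong ∼ (cong₂ _∧_ (sym (∼-invol x)) (sym (∼-invol y))) ⟩
    ∼ (∼ (∼ x) ∧ ∼ (∼ y))  ≡⟨ cong ∼ (sym (∼-deMorgan (∼ x) (∼ y))) ⟩
    ∼ (∼ (∼ x ∨ ∼ y))      ≡⟨ ∼-invol (∼ x ∨ ∼ y) ⟩
    ∼ x ∨ ∼ y              ∎

  C⇒∼≤c : ∀ {x} → C U x → ∼ x ≤ c
  C⇒∼≤c c≤x = subst (_ ≤_) ∼-c (∼-antitone c≤x)

  ∼x∨c∧x∨c≡c : ∀ x → (∼ x ∨ c) ∧ (x ∨ c) ≡ c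
  ∼x∨c∧x∨c≡c x = begin
    (∼ x ∨ c) ∧ (x ∨ c)  ≡⟨ sym (∨-distribʳ-∧ (∼ x) x c) ⟩
    (∼ x ∧ x) ∨ c        ≡⟨ x≤y⇒x∨y≡y ∼x∧x≤c ⟩
    c                    ∎
    where
    c∨∼c≡c : c ∨ ∼ c ≡ c
    c∨∼c≡c = trans (cong (c ∨_) ∼-c) (x≤y⇒x∨y≡y (≤-refl c))
    ∼x∧x≤c : (∼ x ∧ x) ≤ c
    ∼x∧x≤c = subst₂ _≤_ (∧-comm x (∼ x)) c∨∼c≡c (kleene x c)

  ⇒-monoʳ : ∀ {x y z} → y ≤ z → (x ⇒ y) ≤ (x ⇒ z)
  ⇒-monoʳ {x} {y} {z} y≤z = trans (⇒-∧ x y z) (cong (x ⇒_) y≤z)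

  x⇒c≡x∨c⇒c : ∀ x → x ⇒ c ≡ (x ∨ c) ⇒ c
  x⇒c≡x∨c⇒c x = begin
    x ⇒ c                ≡⟨ sym (𝟙-top (x ⇒ c)) ⟩
    (x ⇒ c) ∧ 𝟙          ≡⟨ cong ((x ⇒ c) ∧_) (sym c⇒c) ⟩
    (x ⇒ c) ∧ (c ⇒ c)    ≡⟨ ⇒-∨ x c c ⟩
    (x ∨ c) ⇒ c          ∎

  C-⇒-closed : ∀ {x y} → C U y → C U (x ⇒ y)
  C-⇒-closed {x} {y} c≤y = begin
    c ∧ (x ⇒ y)    ≡⟨ ∧-comm c (x ⇒ y) ⟩
    (x ⇒ y) ∧ c    ≡⟨ ki-c x y ⟩
    (∼ x ∨ y) ∧ c  ≡⟨ ∧-comm (∼ x ∨ y) c ⟩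
    c ∧ (∼ x ∨ y)  ≡⟨ ≤-trans c≤y (y≤x∨y (∼ x) y) ⟩
    c              ∎

  c≤x⇒c : ∀ x → C U (x ⇒ c)
  c≤x⇒c x = C-⇒-closed (≤-refl c)

  C⇒∼x⇒c≡𝟙 : ∀ {x} → C U x → ∼ x ⇒ c ≡ 𝟙
  C⇒∼x⇒c≡𝟙 {x} c≤x = begin
    ∼ x ⇒ c        ≡⟨ x⇒c≡x∨c⇒c (∼ x) ⟩
    (∼ x ∨ c) ⇒ c  ≡⟨ cong (_⇒ c) (x≤y⇒x∨y≡y (C⇒∼≤c c≤x)) ⟩
    c ⇒ c          ≡⟨ c⇒c ⟩
    𝟙              ∎

  x⇒x∨c≡𝟙 : ∀ x → x ⇒ (x ∨ c) ≡ 𝟙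
  x⇒x∨c≡𝟙 x = ≤-antisym (x≤𝟙 _) (subst (_≤ (x ⇒ (x ∨ c))) (⇒-refl x) (⇒-monoʳ (x≤x∨y x c)))

  mp-C : ∀ {x y} → C U y → (x ∧ (x ⇒ y)) ≤ y
  mp-C {x} {y} c≤y = ≤-trans (x≤x∨y _ c) (subst (((x ∧ (x ⇒ y)) ∨ c) ≤_) (C⇒x∨c≡x c≤y) (ki-mp x y))

  C⇒𝟙⇒x≤x : ∀ {x} → C U x → (𝟙 ⇒ x) ≤ x
  C⇒𝟙⇒x≤x {x} c≤x = subst (_≤ x) (∧-identityˡ (𝟙 ⇒ x)) (mp-C c≤x)

  ∼[x⇒y]∨c≡x∧∼y∨c : ∀ x y → ∼ (x ⇒ y) ∨ c ≡ (x ∧ ∼ y) ∨ c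
  ∼[x⇒y]∨c≡x∧∼y∨c x y = begin
    ∼ (x ⇒ y) ∨ c        ≡⟨ cong (∼ (x ⇒ y) ∨_) (sym ∼-c) ⟩
    ∼ (x ⇒ y) ∨ ∼ c      ≡⟨ sym (∼-deMorgan-∧ (x ⇒ y) c) ⟩
    ∼ ((x ⇒ y) ∧ c)      ≡⟨ cong ∼ (ki-c x y) ⟩
    ∼ ((∼ x ∨ y) ∧ c)    ≡⟨ ∼-deMorgan-∧ (∼ x ∨ y) c ⟩
    ∼ (∼ x ∨ y) ∨ ∼ c    ≡⟨ cong₂ _∨_ (trans (∼-deMorgan (∼ x) y) (cong (_∧ ∼ y) (∼-invol x))) ∼-c ⟩
    (x ∧ ∼ y) ∨ c        ∎

  ∼y∨c∧x∨c⇒c≡∼[x⇒y]⇒c : ∀ x y → ((∼ y ∨ c) ∧ (x ∨ c)) ⇒ c ≡ ∼ (x ⇒ y) ⇒ c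
  ∼y∨c∧x∨c⇒c≡∼[x⇒y]⇒c x y = begin
    ((∼ y ∨ c) ∧ (x ∨ c)) ⇒ c  ≡⟨ cong (_⇒ c) (sym (∨-distribʳ-∧ (∼ y) x c)) ⟩
    ((∼ y ∧ x) ∨ c) ⇒ c        ≡⟨ cong (λ t → (t ∨ c) ⇒ c) (∧-comm (∼ y) x) ⟩
    ((x ∧ ∼ y) ∨ c) ⇒ c        ≡⟨ cong (_⇒ c) (sym (∼[x⇒y]∨c≡x∧∼y∨c x y)) ⟩
    (∼ (x ⇒ y) ∨ c) ⇒ c        ≡⟨ sym (x⇒c≡x∨c⇒c (∼ (x ⇒ y))) ⟩
    ∼ (x ⇒ y) ⇒ c              ∎

  Tense1Filter-resp-≐ : ∀ {A B : Pred T ℓ} → _≐_ U A B → Tense1Filter U A → Tense1Filter U B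
  Tense1Filter-resp-≐ (A⊆B , B⊆A) fA = record
    { sub-C     = λ b → sub-C (B⊆A b)
    ; has-𝟙     = A⊆B has-𝟙
    ; up-closed = λ b c≤y x≤y → A⊆B (up-closed (B⊆A b) c≤y x≤y)
    ; ∧-closed  = λ b b′ → A⊆B (∧-closed (B⊆A b) (B⊆A b′))
    ; one-cond  = λ c≤a c≤b f → A⊆B (one-cond c≤a c≤b (B⊆A f))
    ; G-closed  = λ b → A⊆B (G-closed (B⊆A b))
    ; H-closed  = λ b → A⊆B (H-closed (B⊆A b))
    }
    where open Tense1Filter fA

  module Tense1FilterProperties {S : Pred T ℓ} (fS : Tense1Filter U S) where
    open Tense1Filter fS

    mp-closed : ∀ {x y} → C U y → S x → S (x ⇒ y) → S y
    mp-closed c≤y x∈S x⇒y∈S = up-closed (∧-closed x∈S x⇒y∈S) c≤y (mp-C c≤y)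

    𝟙⇒-closed : ∀ {x} → S x → S (𝟙 ⇒ x)
    𝟙⇒-closed {x} x∈S = mp-closed (C-⇒-closed c≤x) has-𝟙 𝟙⇒[𝟙⇒x]∈S
      where
      c≤x = sub-C x∈S
      𝟙⇒[𝟙⇒x]∈S : S (𝟙 ⇒ (𝟙 ⇒ x))
      𝟙⇒[𝟙⇒x]∈S = subst (λ t → S (t ⇒ (𝟙 ⇒ x))) (trans (cong (_⇒ x) (∧-identityˡ x)) (⇒-refl x))
                    (one-cond (x≤𝟙 c) c≤x x∈S)

    𝟙⇒-reflect : ∀ {x} → C U x → S (𝟙 ⇒ x) → S x
    𝟙⇒-reflect c≤x 𝟙⇒x∈S = up-closed 𝟙⇒x∈S c≤x (C⇒𝟙⇒x≤x c≤x)

    D-∨c : ∀ {u} → D[_] U S u → S (u ∨ c)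
    D-∨c {u} (_ , 𝟙⇒u∨c∈S) = 𝟙⇒-reflect (c≤x∨c u) 𝟙⇒u∨c∈S

    S[D]⊆S : S[_] U (D[_] U S) ⊆ S
    S[D]⊆S (u∈D , c≤u) = subst S (C⇒x∨c≡x c≤u) (D-∨c u∈D)

    S⊆S[D] : S ⊆ S[_] U (D[_] U S)
    S⊆S[D] {x} x∈S = (∼x⇒c∈S , 𝟙⇒-closed (subst S (sym (C⇒x∨c≡x c≤x)) x∈S)) , c≤x
      where
      c≤x = sub-C x∈S
      ∼x⇒c∈S : S (∼ x ⇒ c)
      ∼x⇒c∈S = subst S (sym (C⇒∼x⇒c≡𝟙 c≤x)) has-𝟙

    D-has-𝟙 : D[_] U S 𝟙
    D-has-𝟙 = subst S (sym (trans (cong (_⇒ c) ∼𝟙≡𝟘) (𝟘-⇒ c))) has-𝟙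
            , subst (λ t → S (𝟙 ⇒ t)) (sym 𝟙∨c≡𝟙) (subst S (sym (⇒-𝟙 𝟙)) has-𝟙)
      where
      𝟙∨c≡𝟙 : 𝟙 ∨ c ≡ 𝟙
      𝟙∨c≡𝟙 = trans (∨-comm 𝟙 c) (x≤y⇒x∨y≡y (x≤𝟙 c))

    D-mp : ∀ {u v} → D[_] U S u → D[_] U S (u ⇒ v) → D[_] U S v
    D-mp {u} {v} u∈D u⇒v∈D = ∼v⇒c∈S , 𝟙⇒-closed v∨c∈S
      where
      one : S ((((∼ v ∨ c) ∧ (u ∨ c)) ⇒ c) ⇒ ((∼ v ∨ c) ⇒ c))
      one = one-cond (c≤x∨c (∼ v)) (≤-refl c) (D-∨c u∈D)
      ∼v⇒c∈S : S (∼ v ⇒ c)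
      ∼v⇒c∈S = subst S (sym (x⇒c≡x∨c⇒c (∼ v)))
                 (mp-closed (c≤x⇒c _) (proj₁ u⇒v∈D)
                   (subst (λ t → S (t ⇒ ((∼ v ∨ c) ⇒ c))) (∼y∨c∧x∨c⇒c≡∼[x⇒y]⇒c u v) one))
      v∨c∈S : S (v ∨ c)
      v∨c∈S = up-closed (∧-closed (D-∨c u∈D) (D-∨c u⇒v∈D)) (c≤x∨c v)
                (subst (_≤ (v ∨ c)) (∨-distribʳ-∧ u (u ⇒ v) c) (ki-mp u v))

    D-tense-closed : (K : T → T) → (∀ {x} → S x → S (K x)) → K c ≡ c →
                     (∀ x y → K (x ⇒ y) ≤ (∼ (K (∼ x)) ⇒ ∼ (K (∼ y)))) →
                     (∀ x y → K (x ∨ y) ≤ (K x ∨ ∼ (K (∼ y)))) →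
                     ∀ {u} → D[_] U S u → D[_] U S (K u)
    D-tense-closed K K-closed Kc K-⇒ K-∨ {u} u∈D = ∼Ku⇒c∈S , 𝟙⇒-closed Ku∨c∈S
      where
      dual-c : ∼ (K (∼ c)) ≡ c
      dual-c = trans (cong (λ t → ∼ (K t)) ∼-c) (trans (cong ∼ Kc) ∼-c)
      dual-∼ : ∼ (K (∼ (∼ u))) ≡ ∼ (K u)
      dual-∼ = cong (λ t → ∼ (K t)) (∼-invol u)
      ∼Ku⇒c∈S : S (∼ (K u) ⇒ c)
      ∼Ku⇒c∈S = up-closed (K-closed (proj₁ u∈D)) (c≤x⇒c _)
                  (subst₂ (λ p q → K (∼ u ⇒ c) ≤ (p ⇒ q)) dual-∼ dual-c (K-⇒ (∼ u) c))
      Ku∨c∈S : S (K u ∨ c)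
      Ku∨c∈S = up-closed (K-closed (D-∨c u∈D)) (c≤x∨c (K u))
                 (subst (λ q → K (u ∨ c) ≤ (K u ∨ q)) dual-c (K-∨ u c))

    D-isCenteredTenseDS : CenteredTenseDS U (D[_] U S)
    D-isCenteredTenseDS = record
      { isTenseDS = record
        { has-𝟙    = D-has-𝟙
        ; mp       = D-mp
        ; G-closed = D-tense-closed G G-closed Gc G-⇒F G-∨
        ; H-closed = D-tense-closed H H-closed Hc H-⇒P H-∨
        }
      ; filter   = Tense1Filter-resp-≐ (S⊆S[D] , S[D]⊆S) fS
      ; centered = λ u d₁ d₂ → S[D]⊆S (d₁ , c≤x⇒c (∼ u)) , S[D]⊆S (d₂ , C-⇒-closed (c≤x∨c u))
      }

  module CenteredTenseDSProperties {D : Pred T ℓ} (cD : CenteredTenseDS U D) where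
    open CenteredTenseDS cD
    open TenseDS isTenseDS using (has-𝟙; mp)
    open Tense1FilterProperties filter using (𝟙⇒-closed; 𝟙⇒-reflect)

    D[S]⊆D : D[_] U (S[_] U D) ⊆ D
    D[S]⊆D {u} ((d₁ , _) , (d₂ , _)) = centered u d₁ d₂

    D⊆D[S] : D ⊆ D[_] U (S[_] U D)
    D⊆D[S] {u} u∈D = ∼u⇒c∈S , 𝟙⇒-closed u∨c∈S
      where
      u∨c∈S : S[_] U D (u ∨ c)
      u∨c∈S = mp u∈D (subst D (sym (x⇒x∨c≡𝟙 u)) has-𝟙) , c≤x∨c u
      one : S[_] U D ((((∼ u ∨ c) ∧ (u ∨ c)) ⇒ c) ⇒ ((∼ u ∨ c) ⇒ c))
      one = Tense1Filter.one-cond filter (c≤x∨c (∼ u)) (≤-refl c) u∨c∈S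
      ∼u⇒c∈S : S[_] U D (∼ u ⇒ c)
      ∼u⇒c∈S = subst (S[_] U D) (sym (x⇒c≡x∨c⇒c (∼ u)))
                 (𝟙⇒-reflect (c≤x⇒c _)
                   (subst (λ t → S[_] U D (t ⇒ ((∼ u ∨ c) ⇒ c)))
                          (trans (cong (_⇒ c) (∼x∨c∧x∨c≡c u)) c⇒c) one))

theorem7p12 : ∀ {a : Level} (U : ItKIc1 a) → OrderIsoFiltersCDS U
theorem7p12 U =
    (λ S fS → D-isCenteredTenseDS fS)
  , (λ D cD → CenteredTenseDS.filter cD)
  , (λ S fS → S[D]⊆S fS , S⊆S[D] fS)
  , (λ D cD → D[S]⊆D cD , D⊆D[S] cD)
  , (λ S S′ _ _ S⊆S′ (s₁ , s₂) → S⊆S′ s₁ , S⊆S′ s₂)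
  , (λ D D′ _ _ D⊆D′ (d , c≤x) → D⊆D′ d , c≤x)
  where
  open Tense1FilterProperties U
  open CenteredTenseDSProperties U
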